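{- Let $X,Y$ be indeterminates and $\theta_n(X,Y)=\mu_n(b_k,\lambda_k)$ with $b_k=2k+X+Y$ ($k\ge0$) and $\lambda_k=(k+X)(k-1+Y)$ ($k\ge1$). For every integer $s\ge1$ there is a polynomial $P_s(J)$ in $J$ of degree $s$ (with coefficients depending on $X,Y$) such that for all integers $J\ge0$, \[ \sum_{k=0}^J\theta_{J+s-k}(X,Y)\frac{(Y-1)_k(X)_k}{k!}=P_s(J)\,\frac{(Y)_J(X+1)_J}{J!}. \]
   Context: For sequences $(b_k)_{k\ge0}$, $(\lambda_k)_{k\ge1}$ let $p_n$ be the monic polynomials with $p_{ -1}=0$, $p_0=1$, $p_{n+1}=(x-b_n)p_n-\lambda_np_{n-1}$; $\mu_n(b_k,\lambda_k)$ denotes $\mathcal L(x^n)$, where $\mathcal L$ is the unique linear functional on polynomials with $\mathcal L(1)=1$ and $\mathcal L(p_m)=0$ for all $m\ge1$. $(a)_m=a(a+1)\cdots(a+m-1)$, $(a)_0=1$. -}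

module Defs where

open import Data.Nat as ℕ using (ℕ; zero; suc; _!; _≤_)
open import Data.Nat.Properties using (_!≢0)
open import Data.Integer using (+_)
open import Data.Rational as ℚ using (ℚ; 0ℚ; 1ℚ)
open import Data.List using (List; []; _∷_; map)
open import Data.Fin using (Fin; toℕ; fromℕ)
open import Data.Product using (_×_; _,_; proj₂; Σ; ∃)
open import Relation.Binary.PropositionalEquality using (_≡_)
open import Relation.Nullary using (¬_)

-- ℚ[X] as coefficient lists (index = power of X)

P1 : Set
P1 = List ℚ

add1 : P1 → P1 → P1
add1 [] q = q
add1 (a ∷ p) [] = a ∷ p
add1 (a ∷ p) (b ∷ q) = (a ℚ.+ b) ∷ add1 p q

mul1 : P1 → P1 → P1
mul1 [] q = []
mul1 (a ∷ p) q = add1 (map (a ℚ.*_) q) (0ℚ ∷ mul1 p q)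

coeff1 : P1 → ℕ → ℚ
coeff1 [] _ = 0ℚ
coeff1 (a ∷ p) zero = a
coeff1 (a ∷ p) (suc i) = coeff1 p i

-- ℚ[X,Y] = ℚ[X][Y] (outer index = power of Y, inner = power of X)

P2 : Set
P2 = List P1

add2 : P2 → P2 → P2
add2 [] q = q
add2 (a ∷ p) [] = a ∷ p
add2 (a ∷ p) (b ∷ q) = add1 a b ∷ add2 p q

mul2 : P2 → P2 → P2
mul2 [] q = []
mul2 (a ∷ p) q = add2 (map (mul1 a) q) ([] ∷ mul2 p q)

neg2 : P2 → P2
neg2 = map (map (λ a → ℚ.- a))

smul2 : ℚ → P2 → P2
smul2 c = map (map (c ℚ.*_))

coeff2 : P2 → ℕ → ℕ → ℚ
coeff2 [] _ _ = 0ℚ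
coeff2 (a ∷ p) zero i = coeff1 a i
coeff2 (a ∷ p) (suc j) i = coeff2 p j i

infix 4 _≈_
_≈_ : P2 → P2 → Set
p ≈ q = ∀ j i → coeff2 p j i ≡ coeff2 q j i

cst : ℚ → P2
cst c = (c ∷ []) ∷ []

𝟘 𝟙 𝕏 𝕐 : P2
𝟘 = []
𝟙 = cst 1ℚ
𝕏 = (0ℚ ∷ 1ℚ ∷ []) ∷ []
𝕐 = [] ∷ (1ℚ ∷ []) ∷ []

nat : ℕ → P2
nat n = cst (+ n ℚ./ 1)

poch : P2 → ℕ → P2
poch a zero = 𝟙
poch a (suc m) = mul2 (poch a m) (add2 a (nat m))

invFact : ℕ → ℚ
invFact m = (+ 1) ℚ./ (m !)
  where instance _ = m !≢0

sumTo : ℕ → (ℕ → P2) → P2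
sumTo zero f = f 0
sumTo (suc J) f = add2 (sumTo J f) (f (suc J))

-- Polynomials in x with coefficients in ℚ[X,Y] (index = power of x)

Px : Set
Px = List P2

addx : Px → Px → Px
addx [] q = q
addx (a ∷ p) [] = a ∷ p
addx (a ∷ p) (b ∷ q) = add2 a b ∷ addx p q

scalex : P2 → Px → Px
scalex c = map (mul2 c)

shiftx : Px → Px
shiftx p = 𝟘 ∷ p

-- (p_{n-1}, p_n) for the monic polynomials
-- p_{-1} = 0, p_0 = 1, p_{n+1} = (x - b_n) p_n - λ_n p_{n-1}
opPair : (ℕ → P2) → (ℕ → P2) → ℕ → Px × Px
opPair b λ' zero = [] , (𝟙 ∷ [])
opPair b λ' (suc n) with opPair b λ' n
... | (q , p) = p , addx (shiftx p) (addx (scalex (neg2 (b n)) p) (scalex (neg2 (λ' n)) q))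

opPoly : (ℕ → P2) → (ℕ → P2) → ℕ → Px
opPoly b λ' n = proj₂ (opPair b λ' n)

applyL : (ℕ → P2) → Px → P2
applyL θ [] = 𝟘
applyL θ (c ∷ p) = add2 (mul2 c (θ 0)) (applyL (λ i → θ (suc i)) p)

-- θ n = μ_n(b_k, λ_k): θ is the moment sequence of the (unique) linear
-- functional L on ℚ[X,Y][x] with L(1) = 1 and L(p_m) = 0 for m ≥ 1,
-- i.e. θ n = L(x^n).
IsMoments : (ℕ → P2) → (ℕ → P2) → (ℕ → P2) → Set
IsMoments b λ' θ = (θ 0 ≈ 𝟙) × (∀ m → 1 ≤ m → applyL θ (opPoly b λ' m) ≈ 𝟘)

bθ : ℕ → P2
bθ k = add2 (nat (2 ℕ.* k)) (add2 𝕏 𝕐)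

λθ : ℕ → P2
λθ k = mul2 (add2 (nat k) 𝕏) (add2 (add2 (nat k) (cst (ℚ.- 1ℚ))) 𝕐)

powQ : ℕ → ℕ → ℚ
powQ J zero = 1ℚ
powQ J (suc i) = (+ J ℚ./ 1) ℚ.* powQ J i

evalJ : (s : ℕ) → (Fin (suc s) → P2) → ℕ → P2
evalJ s c J = go s (λ i → c i)
  where
  go : (t : ℕ) → (Fin (suc t) → P2) → P2
  go zero c' = smul2 (powQ J 0) (c' Data.Fin.zero)
  go (suc t) c' = add2 (go t (λ i → c' (Data.Fin.inject₁ i)))
                       (smul2 (powQ J (suc t)) (c' (fromℕ (suc t))))

module Submission where

-- Write G(n,h) = L(x^n p_h). Multiplying the recurrence of the p_h by x gives
-- G(n+1,h) = G(n,h+1) + b_h G(n,h) + λ_h G(n,h-1), with G(n,0) = θ_n and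
-- G(0,h) = [h = 0]. Hence the sums H_s(J,h) = Σ_k a_k G(J+s-k,h), where
-- a_k = (Y-1)_k (X)_k / k!, obey the same recurrence in (s,h). For s = 0 one has
-- H_0(J,h) = r_J J(J-1)⋯(J-h+1) with r_J = (Y)_J (X+1)_J / J!, by induction on J;
-- the step is the contiguity identity
--   (J-h)(J-h-1) + b_{h+1}(J-h) + λ_{h+1} = (Y+J)(X+1+J) = (J+1) r_{J+1} / r_J
-- (and its analogue for h = 0). Consequently H_s(J,h) = r_J P_{s,h}(J), where
-- P_{s+1,h} = P_{s,h+1} + b_h P_{s,h} + λ_h P_{s,h-1} starts from the falling
-- factorials and is monic of degree s+h in J. The theorem is the case h = 0, d = 1.

open import Algebra.Bundles using (CommutativeRing; RawRing)
open import Algebra.Core using (Op₂)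
open import Algebra.Structures using (IsCommutativeRing)
open import Algebra.Morphism.Structures using (IsRingMonomorphism)
import Algebra.Morphism.RingMonomorphism as RingMonomorphism
open import Data.List using (List; []; _∷_; map; drop)
open import Data.List.Properties using (map-cong)
open import Data.Maybe using (Maybe; just; nothing)
open import Data.Nat as ℕ using (ℕ; zero; suc; _≤_; _<_; s≤s; z≤n; NonZero)
import Data.Nat.Properties as ℕ
open import Data.Product using (Σ; _×_; _,_; proj₁)
open import Function using (id)
open import Relation.Binary.PropositionalEquality as ≡ using (_≡_; cong; cong₂; subst)

module ListPolynomial {c ℓ} (R : CommutativeRing c ℓ) where

  open CommutativeRing R renaming (Carrier to A) hiding (zero; isCommutativeRing)
  open import Algebra.Properties.Ring ring using (-0#≈0#)
  open import Relation.Binary.Reasoning.Setoid setoid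

  Poly : Set c
  Poly = List A

  infixl 6 _⊕_
  infixl 7 _⊛_ _·_
  infix 4 _≐_

  _⊕_ : Poly → Poly → Poly
  [] ⊕ q = q
  (a ∷ p) ⊕ [] = a ∷ p
  (a ∷ p) ⊕ (b ∷ q) = (a + b) ∷ (p ⊕ q)

  _·_ : A → Poly → Poly
  a · p = map (a *_) p

  _⊛_ : Poly → Poly → Poly
  [] ⊛ q = []
  (a ∷ p) ⊛ q = a · q ⊕ (0# ∷ p ⊛ q)

  ⊝_ : Poly → Poly
  ⊝_ = map (-_)

  coeff : Poly → ℕ → A
  coeff [] _ = 0#
  coeff (a ∷ p) zero = a
  coeff (a ∷ p) (suc i) = coeff p i

  record _≐_ (p q : Poly) : Set ℓ where
    constructor coeffwise
    field at : ∀ i → coeff p i ≈ coeff q i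
  open _≐_ public

  ≐-refl : ∀ {p} → p ≐ p
  ≐-refl = coeffwise λ _ → refl

  ≐-sym : ∀ {p q} → p ≐ q → q ≐ p
  ≐-sym e = coeffwise λ i → sym (at e i)

  ≐-trans : ∀ {p q r} → p ≐ q → q ≐ r → p ≐ r
  ≐-trans e f = coeffwise λ i → trans (at e i) (at f i)

  ∷-cong : ∀ {a b p q} → a ≈ b → p ≐ q → a ∷ p ≐ b ∷ q
  ∷-cong e f = coeffwise λ { zero → e ; (suc i) → at f i }

  ∷-tail : ∀ {a b p q} → a ∷ p ≐ b ∷ q → p ≐ q
  ∷-tail e = coeffwise λ i → at e (suc i)

  ∷-tail₀ : ∀ {a p} → a ∷ p ≐ [] → p ≐ []
  ∷-tail₀ e = coeffwise λ i → at e (suc i)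

  0∷[]≐[] : 0# ∷ [] ≐ []
  0∷[]≐[] = coeffwise λ { zero → refl ; (suc i) → refl }

  0∷-cong₀ : ∀ {p} → p ≐ [] → 0# ∷ p ≐ []
  0∷-cong₀ e = coeffwise λ { zero → refl ; (suc i) → at e i }

  coeff-⊕ : ∀ p q i → coeff (p ⊕ q) i ≈ coeff p i + coeff q i
  coeff-⊕ [] q i = sym (+-identityˡ _)
  coeff-⊕ (a ∷ p) [] i = sym (+-identityʳ _)
  coeff-⊕ (a ∷ p) (b ∷ q) zero = refl
  coeff-⊕ (a ∷ p) (b ∷ q) (suc i) = coeff-⊕ p q i

  coeff-· : ∀ a p i → coeff (a · p) i ≈ a * coeff p i
  coeff-· a [] i = sym (zeroʳ a)
  coeff-· a (b ∷ p) zero = refl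
  coeff-· a (b ∷ p) (suc i) = coeff-· a p i

  coeff-⊝ : ∀ p i → coeff (⊝ p) i ≈ - coeff p i
  coeff-⊝ [] i = sym -0#≈0#
  coeff-⊝ (a ∷ p) zero = refl
  coeff-⊝ (a ∷ p) (suc i) = coeff-⊝ p i

  ⊕-cong : ∀ {p p′ q q′} → p ≐ p′ → q ≐ q′ → p ⊕ q ≐ p′ ⊕ q′
  ⊕-cong {p} {p′} {q} {q′} e f = coeffwise λ i → begin
    coeff (p ⊕ q) i         ≈⟨ coeff-⊕ p q i ⟩
    coeff p i + coeff q i   ≈⟨ +-cong (at e i) (at f i) ⟩
    coeff p′ i + coeff q′ i ≈⟨ coeff-⊕ p′ q′ i ⟨
    coeff (p′ ⊕ q′) i       ∎

  ⊕-comm : ∀ p q → p ⊕ q ≐ q ⊕ p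
  ⊕-comm p q = coeffwise λ i → begin
    coeff (p ⊕ q) i       ≈⟨ coeff-⊕ p q i ⟩
    coeff p i + coeff q i ≈⟨ +-comm _ _ ⟩
    coeff q i + coeff p i ≈⟨ coeff-⊕ q p i ⟨
    coeff (q ⊕ p) i       ∎

  ⊕-assoc : ∀ p q r → (p ⊕ q) ⊕ r ≐ p ⊕ (q ⊕ r)
  ⊕-assoc p q r = coeffwise λ i → begin
    coeff ((p ⊕ q) ⊕ r) i               ≈⟨ coeff-⊕ (p ⊕ q) r i ⟩
    coeff (p ⊕ q) i + coeff r i         ≈⟨ +-congʳ (coeff-⊕ p q i) ⟩
    (coeff p i + coeff q i) + coeff r i ≈⟨ +-assoc _ _ _ ⟩
    coeff p i + (coeff q i + coeff r i) ≈⟨ +-congˡ (coeff-⊕ q r i) ⟨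
    coeff p i + coeff (q ⊕ r) i         ≈⟨ coeff-⊕ p (q ⊕ r) i ⟨
    coeff (p ⊕ (q ⊕ r)) i               ∎

  ⊕-identityʳ : ∀ p → p ⊕ [] ≐ p
  ⊕-identityʳ [] = ≐-refl
  ⊕-identityʳ (a ∷ p) = ≐-refl

  ⊕-inverseʳ : ∀ p → p ⊕ ⊝ p ≐ []
  ⊕-inverseʳ p = coeffwise λ i → begin
    coeff (p ⊕ ⊝ p) i          ≈⟨ coeff-⊕ p (⊝ p) i ⟩
    coeff p i + coeff (⊝ p) i  ≈⟨ +-congˡ (coeff-⊝ p i) ⟩
    coeff p i + - coeff p i    ≈⟨ -‿inverseʳ _ ⟩
    0#                         ∎

  ⊕-inverseˡ : ∀ p → ⊝ p ⊕ p ≐ []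
  ⊕-inverseˡ p = ≐-trans (⊕-comm (⊝ p) p) (⊕-inverseʳ p)

  ⊝-cong : ∀ {p q} → p ≐ q → ⊝ p ≐ ⊝ q
  ⊝-cong {p} {q} e = coeffwise λ i →
    trans (coeff-⊝ p i) (trans (-‿cong (at e i)) (sym (coeff-⊝ q i)))

  ·-cong : ∀ {a b p q} → a ≈ b → p ≐ q → a · p ≐ b · q
  ·-cong {a} {b} {p} {q} e f = coeffwise λ i →
    trans (coeff-· a p i) (trans (*-cong e (at f i)) (sym (coeff-· b q i)))

  ·-distrib-⊕ : ∀ a p q → a · (p ⊕ q) ≐ a · p ⊕ a · q
  ·-distrib-⊕ a p q = coeffwise λ i → begin
    coeff (a · (p ⊕ q)) i                ≈⟨ coeff-· a (p ⊕ q) i ⟩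
    a * coeff (p ⊕ q) i                  ≈⟨ *-congˡ (coeff-⊕ p q i) ⟩
    a * (coeff p i + coeff q i)          ≈⟨ distribˡ _ _ _ ⟩
    a * coeff p i + a * coeff q i        ≈⟨ +-cong (coeff-· a p i) (coeff-· a q i) ⟨
    coeff (a · p) i + coeff (a · q) i    ≈⟨ coeff-⊕ (a · p) (a · q) i ⟨
    coeff (a · p ⊕ a · q) i              ∎

  +-distrib-· : ∀ a b p → (a + b) · p ≐ a · p ⊕ b · p
  +-distrib-· a b p = coeffwise λ i → begin
    coeff ((a + b) · p) i                ≈⟨ coeff-· (a + b) p i ⟩
    (a + b) * coeff p i                  ≈⟨ distribʳ _ _ _ ⟩
    a * coeff p i + b * coeff p i        ≈⟨ +-cong (coeff-· a p i) (coeff-· b p i) ⟨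
    coeff (a · p) i + coeff (b · p) i    ≈⟨ coeff-⊕ (a · p) (b · p) i ⟨
    coeff (a · p ⊕ b · p) i              ∎

  ·-assoc : ∀ a b p → a · (b · p) ≐ (a * b) · p
  ·-assoc a b p = coeffwise λ i → begin
    coeff (a · (b · p)) i  ≈⟨ coeff-· a (b · p) i ⟩
    a * coeff (b · p) i    ≈⟨ *-congˡ (coeff-· b p i) ⟩
    a * (b * coeff p i)    ≈⟨ *-assoc _ _ _ ⟨
    (a * b) * coeff p i    ≈⟨ coeff-· (a * b) p i ⟨
    coeff ((a * b) · p) i  ∎

  ·-identityˡ : ∀ p → 1# · p ≐ p
  ·-identityˡ p = coeffwise λ i → trans (coeff-· 1# p i) (*-identityˡ _)

  ·-zeroˡ : ∀ p → 0# · p ≐ []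
  ·-zeroˡ p = coeffwise λ i → trans (coeff-· 0# p i) (zeroˡ _)

  ·-0∷ : ∀ a p → a · (0# ∷ p) ≐ 0# ∷ a · p
  ·-0∷ a p = ∷-cong (zeroʳ a) ≐-refl

  ⊛-zeroˡ-≐ : ∀ {p} q → p ≐ [] → p ⊛ q ≐ []
  ⊛-zeroˡ-≐ {[]} q e = ≐-refl
  ⊛-zeroˡ-≐ {a ∷ p} q e =
    ≐-trans (⊕-cong (·-cong (at e zero) ≐-refl) (∷-cong refl (⊛-zeroˡ-≐ q (∷-tail₀ e))))
            (⊕-cong (·-zeroˡ q) 0∷[]≐[])

  ⊛-congˡ : ∀ {p p′} q → p ≐ p′ → p ⊛ q ≐ p′ ⊛ q
  ⊛-congˡ {[]} q e = ≐-sym (⊛-zeroˡ-≐ q (≐-sym e))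
  ⊛-congˡ {a ∷ p} {[]} q e = ⊛-zeroˡ-≐ q e
  ⊛-congˡ {a ∷ p} {b ∷ p′} q e =
    ⊕-cong (·-cong (at e zero) ≐-refl) (∷-cong refl (⊛-congˡ q (∷-tail e)))

  ⊛-congʳ : ∀ p {q q′} → q ≐ q′ → p ⊛ q ≐ p ⊛ q′
  ⊛-congʳ [] e = ≐-refl
  ⊛-congʳ (a ∷ p) e = ⊕-cong (·-cong refl e) (∷-cong refl (⊛-congʳ p e))

  ⊛-cong : ∀ {p p′ q q′} → p ≐ p′ → q ≐ q′ → p ⊛ q ≐ p′ ⊛ q′
  ⊛-cong {p} {p′} {q} e f = ≐-trans (⊛-congˡ q e) (⊛-congʳ p′ f)

  ⊛-zeroʳ : ∀ p → p ⊛ [] ≐ []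
  ⊛-zeroʳ [] = ≐-refl
  ⊛-zeroʳ (a ∷ p) = 0∷-cong₀ (⊛-zeroʳ p)

  ⊕-leftComm : ∀ p q r → p ⊕ (q ⊕ r) ≐ q ⊕ (p ⊕ r)
  ⊕-leftComm p q r =
    ≐-trans (≐-sym (⊕-assoc p q r)) (≐-trans (⊕-cong (⊕-comm p q) ≐-refl) (⊕-assoc q p r))

  ⊕-interchange : ∀ p q r s → (p ⊕ q) ⊕ (r ⊕ s) ≐ (p ⊕ r) ⊕ (q ⊕ s)
  ⊕-interchange p q r s =
    ≐-trans (⊕-assoc p q (r ⊕ s))
            (≐-trans (⊕-cong (≐-refl {p}) (⊕-leftComm q r s)) (≐-sym (⊕-assoc p r (q ⊕ s))))

  ⊛-∷ʳ : ∀ p b q → p ⊛ (b ∷ q) ≐ b · p ⊕ (0# ∷ p ⊛ q)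
  ⊛-∷ʳ [] b q = ≐-sym 0∷[]≐[]
  ⊛-∷ʳ (a ∷ p) b q =
    ∷-cong (trans (+-identityʳ _) (trans (*-comm a b) (sym (+-identityʳ _))))
           (≐-trans (⊕-cong ≐-refl (⊛-∷ʳ p b q)) (⊕-leftComm (a · q) (b · p) (0# ∷ p ⊛ q)))

  ⊛-comm : ∀ p q → p ⊛ q ≐ q ⊛ p
  ⊛-comm [] q = ≐-sym (⊛-zeroʳ q)
  ⊛-comm (a ∷ p) q = ≐-trans (⊕-cong ≐-refl (∷-cong refl (⊛-comm p q))) (≐-sym (⊛-∷ʳ q a p))

  ⊛-distribʳ : ∀ r p q → (p ⊕ q) ⊛ r ≐ p ⊛ r ⊕ q ⊛ r
  ⊛-distribʳ r [] q = ≐-refl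
  ⊛-distribʳ r (a ∷ p) [] = ≐-sym (⊕-identityʳ _)
  ⊛-distribʳ r (a ∷ p) (b ∷ q) =
    ≐-trans (⊕-cong (+-distrib-· a b r) (∷-cong (sym (+-identityʳ 0#)) (⊛-distribʳ r p q)))
            (⊕-interchange (a · r) (b · r) (0# ∷ p ⊛ r) (0# ∷ q ⊛ r))

  ⊛-distribˡ : ∀ p q r → p ⊛ (q ⊕ r) ≐ p ⊛ q ⊕ p ⊛ r
  ⊛-distribˡ p q r =
    ≐-trans (⊛-comm p (q ⊕ r)) (≐-trans (⊛-distribʳ p q r) (⊕-cong (⊛-comm q p) (⊛-comm r p)))

  ·-⊛ : ∀ a p q → a · p ⊛ q ≐ a · (p ⊛ q)
  ·-⊛ a [] q = ≐-refl
  ·-⊛ a (b ∷ p) q =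
    ≐-trans (⊕-cong (≐-sym (·-assoc a b q)) (∷-cong refl (·-⊛ a p q)))
            (≐-sym (≐-trans (·-distrib-⊕ a (b · q) (0# ∷ p ⊛ q)) (⊕-cong ≐-refl (·-0∷ a (p ⊛ q)))))

  ⊛-assoc : ∀ p q r → (p ⊛ q) ⊛ r ≐ p ⊛ (q ⊛ r)
  ⊛-assoc [] q r = ≐-refl
  ⊛-assoc (a ∷ p) q r =
    ≐-trans (⊛-distribʳ r (a · q) (0# ∷ p ⊛ q))
            (⊕-cong (·-⊛ a q r) (≐-trans (⊕-cong (·-zeroˡ r) ≐-refl) (∷-cong refl (⊛-assoc p q r))))

  𝟏 : Poly
  𝟏 = 1# ∷ []

  ⊛-identityˡ : ∀ p → 𝟏 ⊛ p ≐ p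
  ⊛-identityˡ p = ≐-trans (⊕-cong (·-identityˡ p) 0∷[]≐[]) (⊕-identityʳ p)

  ⊛-identityʳ : ∀ p → p ⊛ 𝟏 ≐ p
  ⊛-identityʳ p = ≐-trans (⊛-comm p 𝟏) (⊛-identityˡ p)

  isCommutativeRing : IsCommutativeRing _≐_ _⊕_ _⊛_ ⊝_ [] 𝟏
  isCommutativeRing = record
    { isRing = record
      { +-isAbelianGroup = record
        { isGroup = record
          { isMonoid = record
            { isSemigroup = record
              { isMagma = record
                { isEquivalence = record { refl = ≐-refl ; sym = ≐-sym ; trans = ≐-trans }
                ; ∙-cong = ⊕-cong }
              ; assoc = ⊕-assoc }
            ; identity = (λ p → ≐-refl) , ⊕-identityʳ }
          ; inverse = ⊕-inverseˡ , ⊕-inverseʳ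
          ; ⁻¹-cong = ⊝-cong }
        ; comm = ⊕-comm }
      ; *-cong = ⊛-cong
      ; *-assoc = ⊛-assoc
      ; *-identity = ⊛-identityˡ , ⊛-identityʳ
      ; distrib = ⊛-distribˡ , ⊛-distribʳ }
    ; *-comm = ⊛-comm }

  commutativeRing : CommutativeRing c ℓ
  commutativeRing = record { isCommutativeRing = isCommutativeRing }

  zeroTest : (∀ a → Maybe (0# ≈ a)) → ∀ p → Maybe ([] ≐ p)
  zeroTest 0≟_ [] = just ≐-refl
  zeroTest 0≟_ (a ∷ p) with 0≟ a | zeroTest 0≟_ p
  ... | just 0≈a | just []≐p = just (coeffwise λ { zero → 0≈a ; (suc i) → at []≐p i })
  ... | _        | _         = nothing

  infix 4 _HasDegree≤_

  record _HasDegree≤_ (p : Poly) (d : ℕ) : Set ℓ where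
    constructor vanishingAbove
    field vanishes : ∀ i → d < i → coeff p i ≈ 0#
  open _HasDegree≤_ public

  record IsMonic (p : Poly) (d : ℕ) : Set ℓ where
    constructor monic
    field
      hasDegree≤ : p HasDegree≤ d
      leading    : coeff p d ≈ 1#
  open IsMonic public

  []-hasDegree≤ : ∀ {d} → [] HasDegree≤ d
  []-hasDegree≤ = vanishingAbove λ _ _ → refl

  hasDegree≤-mono : ∀ {p d e} → d ≤ e → p HasDegree≤ d → p HasDegree≤ e
  hasDegree≤-mono d≤e deg = vanishingAbove λ i e<i → vanishes deg i (ℕ.≤-<-trans d≤e e<i)

  ⊕-hasDegree≤ : ∀ {p q d} → p HasDegree≤ d → q HasDegree≤ d → p ⊕ q HasDegree≤ d
  ⊕-hasDegree≤ {p} {q} degp degq = vanishingAbove λ i d<i → begin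
    coeff (p ⊕ q) i       ≈⟨ coeff-⊕ p q i ⟩
    coeff p i + coeff q i ≈⟨ +-cong (vanishes degp i d<i) (vanishes degq i d<i) ⟩
    0# + 0#               ≈⟨ +-identityˡ 0# ⟩
    0#                    ∎

  ·-hasDegree≤ : ∀ a {p d} → p HasDegree≤ d → a · p HasDegree≤ d
  ·-hasDegree≤ a {p} degp = vanishingAbove λ i d<i →
    trans (coeff-· a p i) (trans (*-congˡ (vanishes degp i d<i)) (zeroʳ a))

  0∷-isMonic : ∀ {p d} → IsMonic p d → IsMonic (0# ∷ p) (suc d)
  0∷-isMonic (monic degp leadp) = monic (vanishingAbove λ { (suc i) (s≤s d<i) → vanishes degp i d<i }) leadp

  ⊕-isMonic : ∀ {p q d} → IsMonic p (suc d) → q HasDegree≤ d → IsMonic (p ⊕ q) (suc d)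
  ⊕-isMonic {p} {q} {d} (monic degp leadp) degq =
    monic (⊕-hasDegree≤ degp (hasDegree≤-mono (ℕ.n≤1+n d) degq)) (begin
      coeff (p ⊕ q) (suc d)             ≈⟨ coeff-⊕ p q (suc d) ⟩
      coeff p (suc d) + coeff q (suc d) ≈⟨ +-cong leadp (vanishes degq (suc d) ℕ.≤-refl) ⟩
      1# + 0#                           ≈⟨ +-identityʳ 1# ⟩
      1#                                ∎)

isCommutativeRing-≗ : ∀ {c ℓ} (R : CommutativeRing c ℓ) → let open CommutativeRing R in
  {_+′_ _*′_ : Op₂ Carrier} → (∀ x y → x +′ y ≡ x + y) → (∀ x y → x *′ y ≡ x * y) →
  IsCommutativeRing _≈_ _+′_ _*′_ -_ 0# 1#
isCommutativeRing-≗ R {_+′_} {_*′_} +′≗+ *′≗* =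
  RingMonomorphism.isCommutativeRing identity isCommutativeRing
  where
  open CommutativeRing R
  raw′ : RawRing _ _
  raw′ = record { Carrier = Carrier ; _≈_ = _≈_ ; _+_ = _+′_ ; _*_ = _*′_ ; -_ = -_ ; 0# = 0# ; 1# = 1# }
  identity : IsRingMonomorphism raw′ rawRing id
  identity = record
    { isRingHomomorphism = record
      { isSemiringHomomorphism = record
        { isNearSemiringHomomorphism = record
          { +-isMonoidHomomorphism = record
            { isMagmaHomomorphism = record
              { isRelHomomorphism = record { cong = id }
              ; homo = λ x y → reflexive (+′≗+ x y) }
            ; ε-homo = refl }
          ; *-homo = λ x y → reflexive (*′≗* x y) }
        ; 1#-homo = refl }
      ; -‿homo = λ _ → refl }
    ; injective = id }

open import Defs
open import Data.Fin as Fin using (Fin; toℕ; fromℕ; inject₁)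
open import Data.Fin.Properties using (toℕ-inject₁; toℕ-fromℕ)
open import Data.Integer as ℤ using (+_)
import Data.Integer.Properties as ℤ
open import Data.Nat using (_+_; _∸_)
import Data.Nat.Tactic.RingSolver as ℕ-Solver
open import Data.Rational as ℚ using (ℚ; 0ℚ; 1ℚ; -_)
import Data.Rational.Properties as ℚ
open import Data.Rational.Unnormalised as ℚᵘ using (mkℚᵘ; *≡*)
import Data.Rational.Unnormalised.Properties as ℚᵘ
open import Relation.Nullary using (¬_)
open import Relation.Nullary.Decidable using (dec⇒maybe)
open import Tactic.RingSolver using (solve-∀)
open import Tactic.RingSolver.Core.AlmostCommutativeRing using (AlmostCommutativeRing; fromCommutativeRing)

module ℚ[X] = ListPolynomial ℚ.+-*-commutativeRing
module ℚ[X][Y] = ListPolynomial ℚ[X].commutativeRing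

add1-≡ : ∀ p q → add1 p q ≡ p ℚ[X].⊕ q
add1-≡ [] q = ≡.refl
add1-≡ (a ∷ p) [] = ≡.refl
add1-≡ (a ∷ p) (b ∷ q) = cong (_ ∷_) (add1-≡ p q)

mul1-≡ : ∀ p q → mul1 p q ≡ p ℚ[X].⊛ q
mul1-≡ [] q = ≡.refl
mul1-≡ (a ∷ p) q = ≡.trans (add1-≡ (map (a ℚ.*_) q) (0ℚ ∷ mul1 p q))
  (cong (λ r → map (a ℚ.*_) q ℚ[X].⊕ (0ℚ ∷ r)) (mul1-≡ p q))

add2-≡ : ∀ p q → add2 p q ≡ p ℚ[X][Y].⊕ q
add2-≡ [] q = ≡.refl
add2-≡ (a ∷ p) [] = ≡.refl
add2-≡ (a ∷ p) (b ∷ q) = cong₂ _∷_ (add1-≡ a b) (add2-≡ p q)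

mul2-≡ : ∀ p q → mul2 p q ≡ p ℚ[X][Y].⊛ q
mul2-≡ [] q = ≡.refl
mul2-≡ (a ∷ p) q = ≡.trans (add2-≡ (map (mul1 a) q) ([] ∷ mul2 p q))
  (cong₂ (λ r s → r ℚ[X][Y].⊕ ([] ∷ s)) (map-cong (mul1-≡ a) q) (mul2-≡ p q))

-- The ring solver matches operations syntactically, so ℚ[X,Y] is built on
-- Defs' add2 and mul2 rather than on the operations of ListPolynomial.
ℚ[X,Y] : CommutativeRing _ _
ℚ[X,Y] = record { isCommutativeRing = isCommutativeRing-≗ ℚ[X][Y].commutativeRing add2-≡ mul2-≡ }

-- The zero test lets the solver cancel coefficients such as 1 + (-1).
ℚ[X,Y]-almost : AlmostCommutativeRing _ _
ℚ[X,Y]-almost = fromCommutativeRing ℚ[X,Y] (ℚ[X][Y].zeroTest (ℚ[X].zeroTest λ a → dec⇒maybe (0ℚ ℚ.≟ a)))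

infix 4 _≋_
_≋_ : P2 → P2 → Set
_≋_ = ℚ[X][Y]._≐_

coeff2-≡ : ∀ p j i → coeff2 p j i ≡ ℚ[X].coeff (ℚ[X][Y].coeff p j) i
coeff2-≡ [] j i = ≡.refl
coeff2-≡ (a ∷ p) zero i = coeff1-≡ a i
  where
  coeff1-≡ : ∀ a i → coeff1 a i ≡ ℚ[X].coeff a i
  coeff1-≡ [] i = ≡.refl
  coeff1-≡ (x ∷ a) zero = ≡.refl
  coeff1-≡ (x ∷ a) (suc i) = coeff1-≡ a i
coeff2-≡ (a ∷ p) (suc j) i = coeff2-≡ p j i

≋⇒≈ : ∀ {p q} → p ≋ q → p ≈ q
≋⇒≈ {p} {q} e j i = ≡.trans (coeff2-≡ p j i) (≡.trans (ℚ[X].at (ℚ[X][Y].at e j) i) (≡.sym (coeff2-≡ q j i)))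

≈⇒≋ : ∀ {p q} → p ≈ q → p ≋ q
≈⇒≋ {p} {q} e = ℚ[X][Y].coeffwise λ j → ℚ[X].coeffwise λ i →
  ≡.trans (≡.sym (coeff2-≡ p j i)) (≡.trans (e j i) (coeff2-≡ q j i))

open CommutativeRing ℚ[X,Y] using
  ( setoid; +-cong; +-congˡ; +-congʳ; +-identityʳ; -‿cong
  ; *-cong; *-congˡ; *-congʳ; *-assoc; *-comm; *-identityˡ; *-identityʳ; zeroˡ; zeroʳ )
  renaming (refl to ≋-refl; sym to ≋-sym; trans to ≋-trans; reflexive to ≋-reflexive)
open import Relation.Binary.Reasoning.Setoid setoid

-- + i / suc k is fromℚᵘ (mkℚᵘ i k) by definition, so these identities are
-- checked in ℚᵘ.
/1-homo-+ : ∀ m n → + (m ℕ.+ n) ℚ./ 1 ≡ (+ m ℚ./ 1) ℚ.+ (+ n ℚ./ 1)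
/1-homo-+ m n = ℚ.toℚᵘ-injective
  (ℚᵘ.≃-trans (ℚ.toℚᵘ-fromℚᵘ (mkℚᵘ (+ (m ℕ.+ n)) 0)) (ℚᵘ.≃-trans sum
  (ℚᵘ.≃-sym (ℚᵘ.≃-trans (ℚ.toℚᵘ-homo-+ (+ m ℚ./ 1) (+ n ℚ./ 1))
    (ℚᵘ.+-cong (ℚ.toℚᵘ-fromℚᵘ (mkℚᵘ (+ m) 0)) (ℚ.toℚᵘ-fromℚᵘ (mkℚᵘ (+ n) 0)))))))
  where
  sum : mkℚᵘ (+ (m ℕ.+ n)) 0 ℚᵘ.≃ mkℚᵘ (+ m) 0 ℚᵘ.+ mkℚᵘ (+ n) 0
  sum = *≡* (cong (ℤ._* + 1) (≡.trans (ℤ.pos-+ m n)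
          (≡.sym (cong₂ ℤ._+_ (ℤ.*-identityʳ (+ m)) (ℤ.*-identityʳ (+ n))))))

1/-cancel : ∀ n d .{{_ : NonZero d}} →
  + 1 ℚ./ d ≡ ((+ 1 ℚ./ (suc n ℕ.* d)) {{ℕ.m*n≢0 (suc n) d}}) ℚ.* (+ suc n ℚ./ 1)
1/-cancel n (suc e) = ℚ.toℚᵘ-injective
  (ℚᵘ.≃-trans (ℚ.toℚᵘ-fromℚᵘ (mkℚᵘ (+ 1) e)) (ℚᵘ.≃-trans frac
  (ℚᵘ.≃-sym (ℚᵘ.≃-trans (ℚ.toℚᵘ-homo-* (+ 1 ℚ./ suc d′) (+ suc n ℚ./ 1))
    (ℚᵘ.*-cong (ℚ.toℚᵘ-fromℚᵘ (mkℚᵘ (+ 1) d′)) (ℚ.toℚᵘ-fromℚᵘ (mkℚᵘ (+ suc n) 0)))))))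
  where
  d′ : ℕ
  d′ = e ℕ.+ n ℕ.* suc e
  frac : mkℚᵘ (+ 1) e ℚᵘ.≃ mkℚᵘ (+ 1) d′ ℚᵘ.* mkℚᵘ (+ suc n) 0
  frac = *≡* (cong (λ k → + suc k) (ℕ-Solver.solve (e ∷ n ∷ [])))

invFact-suc : ∀ m → invFact m ≡ invFact (suc m) ℚ.* (+ suc m ℚ./ 1)
invFact-suc m = 1/-cancel m (m ℕ.!) {{m ℕ.!≢0}}

nat-+ : ∀ m n → nat (m ℕ.+ n) ≋ add2 (nat m) (nat n)
nat-+ m n = ≋-reflexive (cong cst (/1-homo-+ m n))

nat-0 : nat 0 ≋ 𝟘
nat-0 = ℚ[X][Y].≐-trans (ℚ[X][Y].∷-cong ℚ[X].0∷[]≐[] ℚ[X][Y].≐-refl) ℚ[X][Y].0∷[]≐[]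

nat-suc : ∀ n → nat (suc n) ≋ add2 𝟙 (nat n)
nat-suc = nat-+ 1

nat-double : ∀ n → nat (2 ℕ.* n) ≋ add2 (nat n) (nat n)
nat-double n = ≋-trans (nat-+ n (n ℕ.+ 0)) (+-congˡ {nat n} (≋-reflexive (cong nat (ℕ.+-identityʳ n))))

cst-* : ∀ a b → cst (a ℚ.* b) ≋ mul2 (cst a) (cst b)
cst-* a b = ℚ[X][Y].∷-cong (ℚ[X].∷-cong (≡.sym (ℚ.+-identityʳ (a ℚ.* b))) ℚ[X].≐-refl) ℚ[X][Y].≐-refl

smul2≋cst-* : ∀ a p → smul2 a p ≋ mul2 (cst a) p
smul2≋cst-* a p = ≋-trans (map-≐ p)
  (≋-trans (≋-sym (≋-trans (ℚ[X][Y].⊕-cong ≋-refl ℚ[X][Y].0∷[]≐[]) (ℚ[X][Y].⊕-identityʳ _)))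
           (≋-reflexive (≡.sym (mul2-≡ (cst a) p))))
  where
  map-≐ : ∀ p → map (a ℚ[X].·_) p ≋ map ((a ∷ []) ℚ[X].⊛_) p
  map-≐ [] = ≋-refl
  map-≐ (q ∷ p) = ℚ[X][Y].∷-cong
    (ℚ[X].≐-sym (ℚ[X].≐-trans (ℚ[X].⊕-cong ℚ[X].≐-refl ℚ[X].0∷[]≐[]) (ℚ[X].⊕-identityʳ _)))
    (map-≐ p)

poch-suc : ∀ c m → poch c (suc m) ≋ mul2 c (poch (add2 c 𝟙) m)
poch-suc c zero = ≋-trans (*-congˡ {𝟙} (+-congˡ {c} nat-0)) (unit c)
  where
  unit : ∀ c → mul2 𝟙 (add2 c 𝟘) ≋ mul2 c 𝟙
  unit = solve-∀ ℚ[X,Y]-almost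
poch-suc c (suc m) = begin
  mul2 (poch c (suc m)) (add2 c (nat (suc m)))
    ≈⟨ *-cong (poch-suc c m) (+-congˡ {c} (nat-suc m)) ⟩
  mul2 (mul2 c (poch (add2 c 𝟙) m)) (add2 c (add2 𝟙 (nat m)))
    ≈⟨ reassociate c (poch (add2 c 𝟙) m) (nat m) ⟩
  mul2 c (mul2 (poch (add2 c 𝟙) m) (add2 (add2 c 𝟙) (nat m))) ∎
  where
  reassociate : ∀ c p n → mul2 (mul2 c p) (add2 c (add2 𝟙 n)) ≋ mul2 c (mul2 p (add2 (add2 c 𝟙) n))
  reassociate = solve-∀ ℚ[X,Y]-almost

poch-cong : ∀ {c c′} m → c ≋ c′ → poch c m ≋ poch c′ m
poch-cong zero c≋c′ = ≋-refl
poch-cong (suc m) c≋c′ = *-cong (poch-cong m c≋c′) (+-congʳ c≋c′)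

sumTo-cong : ∀ J {f g : ℕ → P2} → (∀ k → k ≤ J → f k ≋ g k) → sumTo J f ≋ sumTo J g
sumTo-cong zero f≋g = f≋g 0 z≤n
sumTo-cong (suc J) f≋g = +-cong (sumTo-cong J λ k k≤J → f≋g k (ℕ.m≤n⇒m≤1+n k≤J)) (f≋g (suc J) ℕ.≤-refl)

sumTo-+ : ∀ J (f g : ℕ → P2) → sumTo J (λ k → add2 (f k) (g k)) ≋ add2 (sumTo J f) (sumTo J g)
sumTo-+ zero f g = ≋-refl
sumTo-+ (suc J) f g = ≋-trans (+-congʳ (sumTo-+ J f g)) (interchange (sumTo J f) (sumTo J g) (f (suc J)) (g (suc J)))
  where
  interchange : ∀ a b c d → add2 (add2 a b) (add2 c d) ≋ add2 (add2 a c) (add2 b d)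
  interchange = solve-∀ ℚ[X,Y]-almost

sumTo-*ˡ : ∀ J c (f : ℕ → P2) → sumTo J (λ k → mul2 c (f k)) ≋ mul2 c (sumTo J f)
sumTo-*ˡ zero c f = ≋-refl
sumTo-*ˡ (suc J) c f = ≋-trans (+-congʳ (sumTo-*ˡ J c f)) (distrib c (sumTo J f) (f (suc J)))
  where
  distrib : ∀ c a b → add2 (mul2 c a) (mul2 c b) ≋ mul2 c (add2 a b)
  distrib = solve-∀ ℚ[X,Y]-almost

sumTo-𝟘 : ∀ J (f : ℕ → P2) → (∀ k → f k ≋ 𝟘) → sumTo J f ≋ 𝟘
sumTo-𝟘 zero f f≋𝟘 = f≋𝟘 0
sumTo-𝟘 (suc J) f f≋𝟘 = +-cong (sumTo-𝟘 J f f≋𝟘) (f≋𝟘 (suc J))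

module ℚ[X,Y][x] = ListPolynomial ℚ[X,Y]
open ℚ[X,Y][x] using
  ( _⊕_; _·_; coeff; _HasDegree≤_; vanishingAbove; vanishes; IsMonic; monic; hasDegree≤; leading
  ; []-hasDegree≤; hasDegree≤-mono; ⊕-hasDegree≤; ·-hasDegree≤; 0∷-isMonic; ⊕-isMonic )

-- prev z f h = f (h - 1), with prev z f 0 = z (the convention p_{-1} = 0).
prev : ∀ {A : Set} → A → (ℕ → A) → ℕ → A
prev z f zero = z
prev z f (suc h) = f h

δ₀ : ℕ → P2
δ₀ zero = 𝟙
δ₀ (suc h) = 𝟘

eval : P2 → Px → P2
eval x [] = 𝟘
eval x (c ∷ p) = add2 c (mul2 x (eval x p))

eval-⊕ : ∀ x p q → eval x (p ⊕ q) ≋ add2 (eval x p) (eval x q)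
eval-⊕ x [] q = ≋-refl
eval-⊕ x (c ∷ p) [] = ≋-sym (+-identityʳ _)
eval-⊕ x (c ∷ p) (d ∷ q) = ≋-trans (+-congˡ {add2 c d} (*-congˡ {x} (eval-⊕ x p q)))
  (regroup c d x (eval x p) (eval x q))
  where
  regroup : ∀ c d x u v → add2 (add2 c d) (mul2 x (add2 u v)) ≋ add2 (add2 c (mul2 x u)) (add2 d (mul2 x v))
  regroup = solve-∀ ℚ[X,Y]-almost

eval-· : ∀ x c p → eval x (c · p) ≋ mul2 c (eval x p)
eval-· x c [] = ≋-sym (zeroʳ c)
eval-· x c (d ∷ p) = ≋-trans (+-congˡ {mul2 c d} (*-congˡ {x} (eval-· x c p))) (factor c d x (eval x p))
  where
  factor : ∀ c d x u → add2 (mul2 c d) (mul2 x (mul2 c u)) ≋ mul2 c (add2 d (mul2 x u))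
  factor = solve-∀ ℚ[X,Y]-almost

applyL-cong : ∀ {θ₁ θ₂ : ℕ → P2} → (∀ i → θ₁ i ≋ θ₂ i) → ∀ p → applyL θ₁ p ≋ applyL θ₂ p
applyL-cong θ₁≋θ₂ [] = ≋-refl
applyL-cong θ₁≋θ₂ (c ∷ p) = +-cong (*-congˡ {c} (θ₁≋θ₂ 0)) (applyL-cong (λ i → θ₁≋θ₂ (suc i)) p)

applyL-addx : ∀ θ p q → applyL θ (addx p q) ≋ add2 (applyL θ p) (applyL θ q)
applyL-addx θ [] q = ≋-refl
applyL-addx θ (c ∷ p) [] = ≋-sym (+-identityʳ _)
applyL-addx θ (c ∷ p) (d ∷ q) =
  ≋-trans (+-congˡ {mul2 (add2 c d) (θ 0)} (applyL-addx (λ i → θ (suc i)) p q))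
          (regroup c d (θ 0) (applyL (λ i → θ (suc i)) p) (applyL (λ i → θ (suc i)) q))
  where
  regroup : ∀ c d t u v → add2 (mul2 (add2 c d) t) (add2 u v) ≋ add2 (add2 (mul2 c t) u) (add2 (mul2 d t) v)
  regroup = solve-∀ ℚ[X,Y]-almost

applyL-scalex : ∀ θ c p → applyL θ (scalex c p) ≋ mul2 c (applyL θ p)
applyL-scalex θ c [] = ≋-sym (zeroʳ c)
applyL-scalex θ c (d ∷ p) =
  ≋-trans (+-congˡ {mul2 (mul2 c d) (θ 0)} (applyL-scalex (λ i → θ (suc i)) c p))
          (factor c d (θ 0) (applyL (λ i → θ (suc i)) p))
  where
  factor : ∀ c d t u → add2 (mul2 (mul2 c d) t) (mul2 c u) ≋ mul2 c (add2 (mul2 d t) u)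
  factor = solve-∀ ℚ[X,Y]-almost

fallingFactorial : ℕ → Px
fallingFactorial zero = 𝟙 ∷ []
fallingFactorial (suc h) = (𝟘 ∷ fallingFactorial h) ⊕ neg2 (nat h) · fallingFactorial h

fallingFactorial-isMonic : ∀ h → IsMonic (fallingFactorial h) h
fallingFactorial-isMonic zero = monic (vanishingAbove λ { (suc i) _ → ≋-refl }) ≋-refl
fallingFactorial-isMonic (suc h) = ⊕-isMonic (0∷-isMonic ff-monic) (·-hasDegree≤ (neg2 (nat h)) (hasDegree≤ ff-monic))
  where
  ff-monic : IsMonic (fallingFactorial h) h
  ff-monic = fallingFactorial-isMonic h

eval-fallingFactorial-0 : ∀ x → eval x (fallingFactorial 0) ≋ 𝟙
eval-fallingFactorial-0 x = unit x
  where
  unit : ∀ x → add2 𝟙 (mul2 x 𝟘) ≋ 𝟙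
  unit = solve-∀ ℚ[X,Y]-almost

eval-fallingFactorial-suc : ∀ x h →
  eval x (fallingFactorial (suc h)) ≋ mul2 (eval x (fallingFactorial h)) (add2 x (neg2 (nat h)))
eval-fallingFactorial-suc x h = begin
  eval x ((𝟘 ∷ f) ⊕ neg2 (nat h) · f)
    ≈⟨ eval-⊕ x (𝟘 ∷ f) (neg2 (nat h) · f) ⟩
  add2 (eval x (𝟘 ∷ f)) (eval x (neg2 (nat h) · f))
    ≈⟨ +-congˡ {eval x (𝟘 ∷ f)} (eval-· x (neg2 (nat h)) f) ⟩
  add2 (eval x (𝟘 ∷ f)) (mul2 (neg2 (nat h)) (eval x f))
    ≈⟨ factor x (eval x f) (nat h) ⟩
  mul2 (eval x f) (add2 x (neg2 (nat h))) ∎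
  where
  f : Px
  f = fallingFactorial h
  factor : ∀ x u n → add2 (add2 𝟘 (mul2 x u)) (mul2 (neg2 n) u) ≋ mul2 u (add2 x (neg2 n))
  factor = solve-∀ ℚ[X,Y]-almost

eval-fallingFactorial-1 : ∀ x → eval x (fallingFactorial 1) ≋ x
eval-fallingFactorial-1 x = begin
  eval x (fallingFactorial 1)
    ≈⟨ eval-fallingFactorial-suc x 0 ⟩
  mul2 (eval x (fallingFactorial 0)) (add2 x (neg2 (nat 0)))
    ≈⟨ *-cong (eval-fallingFactorial-0 x) (+-congˡ {x} (-‿cong nat-0)) ⟩
  mul2 𝟙 (add2 x (neg2 𝟘))
    ≈⟨ unit x ⟩
  x ∎
  where
  unit : ∀ x → mul2 𝟙 (add2 x (neg2 𝟘)) ≋ x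
  unit = solve-∀ ℚ[X,Y]-almost

eval-fallingFactorial-at-0 : ∀ h → eval (nat 0) (fallingFactorial h) ≋ δ₀ h
eval-fallingFactorial-at-0 zero = eval-fallingFactorial-0 (nat 0)
eval-fallingFactorial-at-0 (suc zero) = ≋-trans (eval-fallingFactorial-1 (nat 0)) nat-0
eval-fallingFactorial-at-0 (suc (suc h)) = begin
  eval (nat 0) (fallingFactorial (suc (suc h)))
    ≈⟨ eval-fallingFactorial-suc (nat 0) (suc h) ⟩
  mul2 (eval (nat 0) (fallingFactorial (suc h))) (add2 (nat 0) (neg2 (nat (suc h))))
    ≈⟨ *-congʳ {add2 (nat 0) (neg2 (nat (suc h)))} (eval-fallingFactorial-at-0 (suc h)) ⟩
  mul2 𝟘 (add2 (nat 0) (neg2 (nat (suc h))))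
    ≈⟨ zeroˡ (add2 (nat 0) (neg2 (nat (suc h)))) ⟩
  𝟘 ∎

eval-fallingFactorial-at-suc : ∀ J h →
  eval (nat (suc J)) (fallingFactorial (suc h)) ≋ mul2 (nat (suc J)) (eval (nat J) (fallingFactorial h))
eval-fallingFactorial-at-suc J zero = begin
  eval (nat (suc J)) (fallingFactorial 1)                ≈⟨ eval-fallingFactorial-1 (nat (suc J)) ⟩
  nat (suc J)                                            ≈⟨ *-identityʳ (nat (suc J)) ⟨
  mul2 (nat (suc J)) 𝟙                                   ≈⟨ *-congˡ {nat (suc J)} (eval-fallingFactorial-0 (nat J)) ⟨
  mul2 (nat (suc J)) (eval (nat J) (fallingFactorial 0)) ∎
eval-fallingFactorial-at-suc J (suc h) = begin
  eval (nat (suc J)) (fallingFactorial (suc (suc h)))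
    ≈⟨ eval-fallingFactorial-suc (nat (suc J)) (suc h) ⟩
  mul2 (eval (nat (suc J)) (fallingFactorial (suc h))) (add2 (nat (suc J)) (neg2 (nat (suc h))))
    ≈⟨ *-cong (eval-fallingFactorial-at-suc J h) (+-cong (nat-suc J) (-‿cong (nat-suc h))) ⟩
  mul2 (mul2 (nat (suc J)) f) (add2 (add2 𝟙 (nat J)) (neg2 (add2 𝟙 (nat h))))
    ≈⟨ shift (nat (suc J)) f (nat J) (nat h) ⟩
  mul2 (nat (suc J)) (mul2 f (add2 (nat J) (neg2 (nat h))))
    ≈⟨ *-congˡ {nat (suc J)} (eval-fallingFactorial-suc (nat J) h) ⟨
  mul2 (nat (suc J)) (eval (nat J) (fallingFactorial (suc h))) ∎
  where
  f : P2
  f = eval (nat J) (fallingFactorial h)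
  shift : ∀ m f n k → mul2 (mul2 m f) (add2 (add2 𝟙 n) (neg2 (add2 𝟙 k))) ≋ mul2 m (mul2 f (add2 n (neg2 k)))
  shift = solve-∀ ℚ[X,Y]-almost

module MixedMoments (b λ′ θ : ℕ → P2) where

  -- G n h = L(x^n p_h) when θ is the moment sequence of L.
  G : ℕ → ℕ → P2
  G n h = applyL (λ i → θ (n + i)) (opPoly b λ′ h)

  G-zeroʳ : ∀ n → G n 0 ≋ θ n
  G-zeroʳ n = ≋-trans (unit (θ (n + 0))) (≋-reflexive (cong θ (ℕ.+-identityʳ n)))
    where
    unit : ∀ t → add2 (mul2 𝟙 t) 𝟘 ≋ t
    unit = solve-∀ ℚ[X,Y]-almost

  G-initial : IsMoments b λ′ θ → ∀ h → G 0 h ≋ δ₀ h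
  G-initial (θ₀≈𝟙 , _) zero = ≋-trans (G-zeroʳ 0) (≈⇒≋ θ₀≈𝟙)
  G-initial (_ , orthogonal) (suc h) = ≈⇒≋ (orthogonal (suc h) (s≤s z≤n))

  applyL-opPoly⁻ : ∀ n h → applyL (λ i → θ (n + i)) (proj₁ (opPair b λ′ h)) ≡ prev 𝟘 (G n) h
  applyL-opPoly⁻ n zero = ≡.refl
  applyL-opPoly⁻ n (suc h) = ≡.refl

  G-recurrence : ∀ n h →
    G (suc n) h ≋ add2 (G n (suc h)) (add2 (mul2 (b h) (G n h)) (mul2 (λ′ h) (prev 𝟘 (G n) h)))
  G-recurrence n h = begin
    G (suc n) h                       ≈⟨ solve-for (G (suc n) h) (b h) (G n h) (λ′ h) (prev 𝟘 (G n) h) ⟩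
    add2 (add2 (G (suc n) h) lower⁻) lower ≈⟨ +-congʳ (≋-sym expand) ⟩
    add2 (G n (suc h)) lower          ∎
    where
    θₙ : ℕ → P2
    θₙ i = θ (n + i)
    p : Px
    p = opPoly b λ′ h
    p⁻ : Px
    p⁻ = proj₁ (opPair b λ′ h)
    lower : P2
    lower = add2 (mul2 (b h) (G n h)) (mul2 (λ′ h) (prev 𝟘 (G n) h))
    lower⁻ : P2
    lower⁻ = add2 (mul2 (neg2 (b h)) (G n h)) (mul2 (neg2 (λ′ h)) (prev 𝟘 (G n) h))
    solve-for : ∀ g b u l v → g ≋ add2 (add2 g (add2 (mul2 (neg2 b) u) (mul2 (neg2 l) v))) (add2 (mul2 b u) (mul2 l v))
    solve-for = solve-∀ ℚ[X,Y]-almost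
    -- x p_h = p_{h+1} + b_h p_h + λ_h p_{h-1}, read through L(x^n ·)
    expand : G n (suc h) ≋ add2 (G (suc n) h) lower⁻
    expand = begin
      applyL θₙ (addx (shiftx p) (addx (scalex (neg2 (b h)) p) (scalex (neg2 (λ′ h)) p⁻)))
        ≈⟨ applyL-addx θₙ (shiftx p) (addx (scalex (neg2 (b h)) p) (scalex (neg2 (λ′ h)) p⁻)) ⟩
      add2 (applyL (λ i → θₙ (suc i)) p) (applyL θₙ (addx (scalex (neg2 (b h)) p) (scalex (neg2 (λ′ h)) p⁻)))
        ≈⟨ +-cong (applyL-cong (λ i → ≋-reflexive (cong θ (ℕ.+-suc n i))) p)
                  (≋-trans (applyL-addx θₙ (scalex (neg2 (b h)) p) (scalex (neg2 (λ′ h)) p⁻))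
                           (+-cong (applyL-scalex θₙ (neg2 (b h)) p) (applyL-scalex θₙ (neg2 (λ′ h)) p⁻))) ⟩
      add2 (G (suc n) h) (add2 (mul2 (neg2 (b h)) (G n h)) (mul2 (neg2 (λ′ h)) (applyL θₙ p⁻)))
        ≈⟨ ≋-reflexive (cong (λ g → add2 (G (suc n) h) (add2 (mul2 (neg2 (b h)) (G n h)) (mul2 (neg2 (λ′ h)) g)))
                             (applyL-opPoly⁻ n h)) ⟩
      add2 (G (suc n) h) lower⁻ ∎

  convolution : (ℕ → P2) → ℕ → ℕ → ℕ → P2
  convolution w s J h = sumTo J (λ k → mul2 (w k) (G (J + s ∸ k) h))

  convolution-recurrence : ∀ w s J h →
    convolution w (suc s) J h ≋
      add2 (convolution w s J (suc h))
           (add2 (mul2 (b h) (convolution w s J h)) (mul2 (λ′ h) (prev 𝟘 (convolution w s J) h)))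
  convolution-recurrence w s J h = begin
    sumTo J (λ k → mul2 (w k) (G (J + suc s ∸ k) h))
      ≈⟨ sumTo-cong J step ⟩
    sumTo J (λ k → add2 (W (suc h) k) (add2 (mul2 (b h) (W h k)) (mul2 (λ′ h) (mul2 (w k) (prev 𝟘 (G (J + s ∸ k)) h)))))
      ≈⟨ ≋-trans (sumTo-+ J (W (suc h)) _) (+-congˡ {convolution w s J (suc h)}
           (≋-trans (sumTo-+ J _ _) (+-cong (sumTo-*ˡ J (b h) (W h)) (sumTo-*ˡ J (λ′ h) _)))) ⟩
    add2 (convolution w s J (suc h))
         (add2 (mul2 (b h) (convolution w s J h)) (mul2 (λ′ h) (sumTo J (λ k → mul2 (w k) (prev 𝟘 (G (J + s ∸ k)) h)))))
      ≈⟨ +-congˡ {convolution w s J (suc h)}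
           (+-congˡ {mul2 (b h) (convolution w s J h)} (*-congˡ {λ′ h} (sum-prev h))) ⟩
    add2 (convolution w s J (suc h))
         (add2 (mul2 (b h) (convolution w s J h)) (mul2 (λ′ h) (prev 𝟘 (convolution w s J) h))) ∎
    where
    W : ℕ → ℕ → P2
    W h k = mul2 (w k) (G (J + s ∸ k) h)
    distribute : ∀ a g₁ b g l g⁻ →
      mul2 a (add2 g₁ (add2 (mul2 b g) (mul2 l g⁻)))
      ≋ add2 (mul2 a g₁) (add2 (mul2 b (mul2 a g)) (mul2 l (mul2 a g⁻)))
    distribute = solve-∀ ℚ[X,Y]-almost
    step : ∀ k → k ≤ J → mul2 (w k) (G (J + suc s ∸ k) h) ≋
      add2 (W (suc h) k) (add2 (mul2 (b h) (W h k)) (mul2 (λ′ h) (mul2 (w k) (prev 𝟘 (G (J + s ∸ k)) h))))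
    step k k≤J = begin
      mul2 (w k) (G (J + suc s ∸ k) h) ≡⟨ cong (λ n → mul2 (w k) (G n h)) index ⟩
      mul2 (w k) (G (suc m) h)         ≈⟨ *-congˡ {w k} (G-recurrence m h) ⟩
      _                                ≈⟨ distribute (w k) (G m (suc h)) (b h) (G m h) (λ′ h) (prev 𝟘 (G m) h) ⟩
      _                                ∎
      where
      m : ℕ
      m = J + s ∸ k
      index : J + suc s ∸ k ≡ suc m
      index = ≡.trans (cong (_∸ k) (ℕ.+-suc J s)) (ℕ.+-∸-assoc 1 (ℕ.m≤n⇒m≤n+o s k≤J))
    sum-prev : ∀ h → sumTo J (λ k → mul2 (w k) (prev 𝟘 (G (J + s ∸ k)) h)) ≋ prev 𝟘 (convolution w s J) h
    sum-prev zero = sumTo-𝟘 J _ (λ k → zeroʳ (w k))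
    sum-prev (suc h) = ≋-refl

  convolution-suc : ∀ w J h →
    convolution w 0 (suc J) h ≋ add2 (convolution w 1 J h) (mul2 (w (suc J)) (G 0 h))
  convolution-suc w J h = +-cong {sumTo J (λ k → mul2 (w k) (G (suc J + 0 ∸ k) h))}
    (sumTo-cong J λ k _ → ≋-reflexive (cong (λ m → mul2 (w k) (G (m ∸ k) h)) (≡.sym (ℕ.+-suc J 0))))
    (≋-reflexive (cong (λ m → mul2 (w (suc J)) (G m h)) (ℕ.m+n∸m≡n J 0)))

lhsWeight : ℕ → P2
lhsWeight k = smul2 (invFact k) (mul2 (poch (add2 𝕐 (cst (ℚ.- 1ℚ))) k) (poch 𝕏 k))

rhsFactor : ℕ → P2
rhsFactor J = smul2 (invFact J) (mul2 (poch 𝕐 J) (poch (add2 𝕏 𝟙) J))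

rhsRatio : ℕ → P2
rhsRatio J = mul2 (add2 𝕐 (nat J)) (add2 (add2 𝕏 𝟙) (nat J))

bθ-0 : bθ 0 ≋ add2 𝕏 𝕐
bθ-0 = +-congʳ {add2 𝕏 𝕐} nat-0

bθ-suc : ∀ h → bθ (suc h) ≋ add2 (add2 (add2 𝟙 (nat h)) (add2 𝟙 (nat h))) (add2 𝕏 𝕐)
bθ-suc h = +-congʳ {add2 𝕏 𝕐} (≋-trans (nat-double (suc h)) (+-cong (nat-suc h) (nat-suc h)))

λθ-suc : ∀ h → λθ (suc h) ≋ mul2 (add2 (add2 𝟙 (nat h)) 𝕏) (add2 (add2 (add2 𝟙 (nat h)) (neg2 𝟙)) 𝕐)
λθ-suc h = *-cong (+-congʳ {𝕏} (nat-suc h)) (+-congʳ {𝕐} (+-congʳ {neg2 𝟙} (nat-suc h)))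

contiguity₀ : ∀ J → add2 (mul2 (nat (suc J)) (add2 (nat J) (bθ 0))) (mul2 (add2 𝕐 (neg2 𝟙)) 𝕏) ≋ rhsRatio J
contiguity₀ J = begin
  add2 (mul2 (nat (suc J)) (add2 (nat J) (bθ 0))) (mul2 (add2 𝕐 (neg2 𝟙)) 𝕏)
    ≈⟨ +-congʳ {mul2 (add2 𝕐 (neg2 𝟙)) 𝕏} (*-cong (nat-suc J) (+-congˡ {nat J} bθ-0)) ⟩
  add2 (mul2 (add2 𝟙 (nat J)) (add2 (nat J) (add2 𝕏 𝕐))) (mul2 (add2 𝕐 (neg2 𝟙)) 𝕏)
    ≈⟨ identity (nat J) 𝕏 𝕐 ⟩
  rhsRatio J ∎
  where
  identity : ∀ n x y →
    add2 (mul2 (add2 𝟙 n) (add2 n (add2 x y))) (mul2 (add2 y (neg2 𝟙)) x) ≋ mul2 (add2 y n) (add2 (add2 x 𝟙) n)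
  identity = solve-∀ ℚ[X,Y]-almost

contiguity : ∀ J h →
  add2 (mul2 (add2 (nat J) (neg2 (nat h))) (add2 (nat J) (neg2 (nat (suc h)))))
       (add2 (mul2 (bθ (suc h)) (add2 (nat J) (neg2 (nat h)))) (λθ (suc h)))
  ≋ rhsRatio J
contiguity J h = begin
  add2 (mul2 d (add2 (nat J) (neg2 (nat (suc h))))) (add2 (mul2 (bθ (suc h)) d) (λθ (suc h)))
    ≈⟨ +-cong (*-congˡ {d} (+-congˡ {nat J} (-‿cong (nat-suc h)))) (+-cong (*-congʳ {d} (bθ-suc h)) (λθ-suc h)) ⟩
  add2 (mul2 d (add2 (nat J) (neg2 (add2 𝟙 (nat h)))))
       (add2 (mul2 (add2 (add2 (add2 𝟙 (nat h)) (add2 𝟙 (nat h))) (add2 𝕏 𝕐)) d)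
             (mul2 (add2 (add2 𝟙 (nat h)) 𝕏) (add2 (add2 (add2 𝟙 (nat h)) (neg2 𝟙)) 𝕐)))
    ≈⟨ identity (nat J) (nat h) 𝕏 𝕐 ⟩
  rhsRatio J ∎
  where
  d : P2
  d = add2 (nat J) (neg2 (nat h))
  identity : ∀ n m x y →
    add2 (mul2 (add2 n (neg2 m)) (add2 n (neg2 (add2 𝟙 m))))
         (add2 (mul2 (add2 (add2 (add2 𝟙 m) (add2 𝟙 m)) (add2 x y)) (add2 n (neg2 m)))
               (mul2 (add2 (add2 𝟙 m) x) (add2 (add2 (add2 𝟙 m) (neg2 𝟙)) y)))
    ≋ mul2 (add2 y n) (add2 (add2 x 𝟙) n)
  identity = solve-∀ ℚ[X,Y]-almost

module _ (J : ℕ) where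
  private
    iF : P2
    iF = cst (invFact (suc J))
    R : P2
    R = mul2 (poch 𝕐 J) (poch (add2 𝕏 𝟙) J)

  rhsFactor-expand : rhsFactor J ≋ mul2 iF (mul2 (nat (suc J)) R)
  rhsFactor-expand = begin
    smul2 (invFact J) R                                   ≈⟨ smul2≋cst-* (invFact J) R ⟩
    mul2 (cst (invFact J)) R                              ≡⟨ cong (λ q → mul2 (cst q) R) (invFact-suc J) ⟩
    mul2 (cst (invFact (suc J) ℚ.* (+ suc J ℚ./ 1))) R ≈⟨ *-congʳ (cst-* (invFact (suc J)) _) ⟩
    mul2 (mul2 iF (nat (suc J))) R                        ≈⟨ *-assoc iF (nat (suc J)) R ⟩
    mul2 iF (mul2 (nat (suc J)) R)                        ∎

  rhsFactor-suc-expand : rhsFactor (suc J) ≋ mul2 iF (mul2 R (rhsRatio J))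
  rhsFactor-suc-expand = ≋-trans (smul2≋cst-* (invFact (suc J)) _)
    (*-congˡ {iF} (regroup (poch 𝕐 J) (add2 𝕐 (nat J)) (poch (add2 𝕏 𝟙) J) (add2 (add2 𝕏 𝟙) (nat J))))
    where
    regroup : ∀ p y q x → mul2 (mul2 p y) (mul2 q x) ≋ mul2 (mul2 p q) (mul2 y x)
    regroup = solve-∀ ℚ[X,Y]-almost

  lhsWeight-suc-expand : lhsWeight (suc J) ≋ mul2 iF (mul2 (mul2 (add2 𝕐 (neg2 𝟙)) 𝕏) R)
  lhsWeight-suc-expand = begin
    smul2 (invFact (suc J)) (mul2 (poch (add2 𝕐 (neg2 𝟙)) (suc J)) (poch 𝕏 (suc J)))
      ≈⟨ smul2≋cst-* (invFact (suc J)) _ ⟩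
    mul2 iF (mul2 (poch (add2 𝕐 (neg2 𝟙)) (suc J)) (poch 𝕏 (suc J)))
      ≈⟨ *-congˡ {iF} (*-cong (≋-trans (poch-suc (add2 𝕐 (neg2 𝟙)) J)
                                        (*-congˡ {add2 𝕐 (neg2 𝟙)} (poch-cong J (cancel 𝕐))))
                              (poch-suc 𝕏 J)) ⟩
    mul2 iF (mul2 (mul2 (add2 𝕐 (neg2 𝟙)) (poch 𝕐 J)) (mul2 𝕏 (poch (add2 𝕏 𝟙) J)))
      ≈⟨ *-congˡ {iF} (regroup (add2 𝕐 (neg2 𝟙)) (poch 𝕐 J) 𝕏 (poch (add2 𝕏 𝟙) J)) ⟩
    mul2 iF (mul2 (mul2 (add2 𝕐 (neg2 𝟙)) 𝕏) R) ∎
    where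
    cancel : ∀ y → add2 (add2 y (neg2 𝟙)) 𝟙 ≋ y
    cancel = solve-∀ ℚ[X,Y]-almost
    regroup : ∀ a p x q → mul2 (mul2 a p) (mul2 x q) ≋ mul2 (mul2 a x) (mul2 p q)
    regroup = solve-∀ ℚ[X,Y]-almost

  rhsFactor-step₀ : add2 (mul2 (rhsFactor J) (add2 (nat J) (bθ 0))) (lhsWeight (suc J)) ≋ rhsFactor (suc J)
  rhsFactor-step₀ = begin
    add2 (mul2 (rhsFactor J) (add2 (nat J) (bθ 0))) (lhsWeight (suc J))
      ≈⟨ +-cong (*-congʳ {add2 (nat J) (bθ 0)} rhsFactor-expand) lhsWeight-suc-expand ⟩
    add2 (mul2 (mul2 iF (mul2 (nat (suc J)) R)) (add2 (nat J) (bθ 0))) (mul2 iF (mul2 (mul2 (add2 𝕐 (neg2 𝟙)) 𝕏) R))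
      ≈⟨ factor iF (nat (suc J)) R (add2 (nat J) (bθ 0)) (mul2 (add2 𝕐 (neg2 𝟙)) 𝕏) ⟩
    mul2 iF (mul2 R (add2 (mul2 (nat (suc J)) (add2 (nat J) (bθ 0))) (mul2 (add2 𝕐 (neg2 𝟙)) 𝕏)))
      ≈⟨ *-congˡ {iF} (*-congˡ {R} (contiguity₀ J)) ⟩
    mul2 iF (mul2 R (rhsRatio J))
      ≈⟨ rhsFactor-suc-expand ⟨
    rhsFactor (suc J) ∎
    where
    factor : ∀ i n r c a → add2 (mul2 (mul2 i (mul2 n r)) c) (mul2 i (mul2 a r)) ≋ mul2 i (mul2 r (add2 (mul2 n c) a))
    factor = solve-∀ ℚ[X,Y]-almost

  rhsFactor-step : ∀ u → mul2 (rhsFactor J) (mul2 u (rhsRatio J)) ≋ mul2 (rhsFactor (suc J)) (mul2 (nat (suc J)) u)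
  rhsFactor-step u = begin
    mul2 (rhsFactor J) (mul2 u (rhsRatio J))
      ≈⟨ *-congʳ {mul2 u (rhsRatio J)} rhsFactor-expand ⟩
    mul2 (mul2 iF (mul2 (nat (suc J)) R)) (mul2 u (rhsRatio J))
      ≈⟨ regroup iF (nat (suc J)) R u (rhsRatio J) ⟩
    mul2 (mul2 iF (mul2 R (rhsRatio J))) (mul2 (nat (suc J)) u)
      ≈⟨ *-congʳ {mul2 (nat (suc J)) u} rhsFactor-suc-expand ⟨
    mul2 (rhsFactor (suc J)) (mul2 (nat (suc J)) u) ∎
    where
    regroup : ∀ i n r u q → mul2 (mul2 i (mul2 n r)) (mul2 u q) ≋ mul2 (mul2 i (mul2 r q)) (mul2 n u)
    regroup = solve-∀ ℚ[X,Y]-almost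

-- P s 0 is the polynomial P_s of the statement.
P : ℕ → ℕ → Px
P zero h = fallingFactorial h
P (suc s) h = P s (suc h) ⊕ (bθ h · P s h ⊕ λθ h · prev [] (P s) h)

P-isMonic : ∀ s h → IsMonic (P s h) (s + h)
P-isMonic zero h = fallingFactorial-isMonic h
P-isMonic (suc s) h =
  ⊕-isMonic (subst (IsMonic (P s (suc h))) (ℕ.+-suc s h) (P-isMonic s (suc h)))
            (⊕-hasDegree≤ (·-hasDegree≤ (bθ h) (hasDegree≤ (P-isMonic s h)))
                          (·-hasDegree≤ (λθ h) (prev-hasDegree≤ h)))
  where
  prev-hasDegree≤ : ∀ h → prev [] (P s) h HasDegree≤ s + h
  prev-hasDegree≤ zero = []-hasDegree≤
  prev-hasDegree≤ (suc h) = hasDegree≤-mono (ℕ.+-monoʳ-≤ s (ℕ.n≤1+n h)) (hasDegree≤ (P-isMonic s h))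

coeff-drop : ∀ m p i → coeff (drop m p) i ≡ coeff p (m + i)
coeff-drop zero p i = ≡.refl
coeff-drop (suc m) [] i = ≡.refl
coeff-drop (suc m) (c ∷ p) i = coeff-drop m p i

eval-drop : ∀ x m p → eval x (drop m p) ≋ add2 (coeff p m) (mul2 x (eval x (drop (suc m) p)))
eval-drop x zero [] = vanish x
  where
  vanish : ∀ x → 𝟘 ≋ add2 𝟘 (mul2 x 𝟘)
  vanish = solve-∀ ℚ[X,Y]-almost
eval-drop x zero (c ∷ p) = ≋-refl
eval-drop x (suc m) [] = eval-drop x zero []
eval-drop x (suc m) (c ∷ p) = eval-drop x m p

eval-vanishing : ∀ x p → (∀ i → coeff p i ≋ 𝟘) → eval x p ≋ 𝟘
eval-vanishing x [] _ = ≋-refl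
eval-vanishing x (c ∷ p) p≋𝟘 = begin
  add2 c (mul2 x (eval x p)) ≈⟨ +-cong (p≋𝟘 0) (*-congˡ {x} (eval-vanishing x p (λ i → p≋𝟘 (suc i)))) ⟩
  add2 𝟘 (mul2 x 𝟘)          ≈⟨ vanish x ⟩
  𝟘                          ∎
  where
  vanish : ∀ x → add2 𝟘 (mul2 x 𝟘) ≋ 𝟘
  vanish = solve-∀ ℚ[X,Y]-almost

-- evalJ adds the monomials from the top degree down, so the induction
-- carries the not yet evaluated tail of p along.
evalJ-split : ∀ J t (c : Fin (suc t) → P2) p → (∀ i → c i ≋ coeff p (toℕ i)) →
  add2 (evalJ t c J) (mul2 (cst (powQ J (suc t))) (eval (nat J) (drop (suc t) p))) ≋ eval (nat J) p
evalJ-split J zero c p c≋p = begin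
  add2 (smul2 1ℚ (c Fin.zero)) (mul2 (cst (powQ J 1)) tail)
    ≈⟨ +-cong (≋-trans (smul2≋cst-* 1ℚ (c Fin.zero)) (*-congˡ {𝟙} (c≋p Fin.zero)))
              (*-congʳ {tail} (cst-* (+ J ℚ./ 1) 1ℚ)) ⟩
  add2 (mul2 𝟙 (coeff p 0)) (mul2 (mul2 (nat J) 𝟙) tail)
    ≈⟨ unit (coeff p 0) (nat J) tail ⟩
  add2 (coeff p 0) (mul2 (nat J) tail)
    ≈⟨ eval-drop (nat J) 0 p ⟨
  eval (nat J) p ∎
  where
  tail : P2
  tail = eval (nat J) (drop 1 p)
  unit : ∀ c n e → add2 (mul2 𝟙 c) (mul2 (mul2 n 𝟙) e) ≋ add2 c (mul2 n e)
  unit = solve-∀ ℚ[X,Y]-almost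
evalJ-split J (suc t) c p c≋p = begin
  add2 (add2 lower (smul2 (powQ J (suc t)) (c (fromℕ (suc t))))) (mul2 (cst (powQ J (suc (suc t)))) tail)
    ≈⟨ +-cong (+-congˡ {lower} (≋-trans (smul2≋cst-* (powQ J (suc t)) _)
                 (*-congˡ {x^t} (≋-trans (c≋p (fromℕ (suc t)))
                                         (≋-reflexive (cong (coeff p) (toℕ-fromℕ (suc t))))))))
              (*-congʳ {tail} (cst-* (+ J ℚ./ 1) (powQ J (suc t)))) ⟩
  add2 (add2 lower (mul2 x^t (coeff p (suc t)))) (mul2 (mul2 (nat J) x^t) tail)
    ≈⟨ factor lower x^t (coeff p (suc t)) (nat J) tail ⟩
  add2 lower (mul2 x^t (add2 (coeff p (suc t)) (mul2 (nat J) tail)))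
    ≈⟨ +-congˡ {lower} (*-congˡ {x^t} (eval-drop (nat J) (suc t) p)) ⟨
  add2 lower (mul2 x^t (eval (nat J) (drop (suc t) p)))
    ≈⟨ evalJ-split J t (λ i → c (inject₁ i)) p
         (λ i → ≋-trans (c≋p (inject₁ i)) (≋-reflexive (cong (coeff p) (toℕ-inject₁ i)))) ⟩
  eval (nat J) p ∎
  where
  lower : P2
  lower = evalJ t (λ i → c (inject₁ i)) J
  x^t : P2
  x^t = cst (powQ J (suc t))
  tail : P2
  tail = eval (nat J) (drop (suc (suc t)) p)
  factor : ∀ g q c n e → add2 (add2 g (mul2 q c)) (mul2 (mul2 n q) e) ≋ add2 g (mul2 q (add2 c (mul2 n e)))
  factor = solve-∀ ℚ[X,Y]-almost

evalJ-coeff : ∀ J s p → p HasDegree≤ s → evalJ s (λ i → coeff p (toℕ i)) J ≋ eval (nat J) p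
evalJ-coeff J s p deg = begin
  evalJ s c J                                                   ≈⟨ vanish (evalJ s c J) x^s ⟩
  add2 (evalJ s c J) (mul2 x^s 𝟘)                               ≈⟨ +-congˡ {evalJ s c J} (*-congˡ {x^s} (≋-sym tail≋𝟘)) ⟩
  add2 (evalJ s c J) (mul2 x^s (eval (nat J) (drop (suc s) p))) ≈⟨ evalJ-split J s c p (λ i → ≋-refl) ⟩
  eval (nat J) p                                                ∎
  where
  c : Fin (suc s) → P2
  c i = coeff p (toℕ i)
  x^s : P2
  x^s = cst (powQ J (suc s))
  vanish : ∀ g q → g ≋ add2 g (mul2 q 𝟘)
  vanish = solve-∀ ℚ[X,Y]-almost
  tail≋𝟘 : eval (nat J) (drop (suc s) p) ≋ 𝟘
  tail≋𝟘 = eval-vanishing (nat J) (drop (suc s) p) λ i →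
    ≋-trans (≋-reflexive (coeff-drop (suc s) p i)) (vanishes deg (suc s + i) (s≤s (ℕ.m≤m+n s i)))

module Moments (θ : ℕ → P2) (moments : IsMoments bθ λθ θ) where
  open MixedMoments bθ λθ θ

  convolution-base : ∀ J h →
    convolution lhsWeight 0 J h ≋ mul2 (rhsFactor J) (eval (nat J) (fallingFactorial h))
  convolution-base zero h =
    *-congˡ {lhsWeight 0} (≋-trans (G-initial moments h) (≋-sym (eval-fallingFactorial-at-0 h)))
  convolution-base (suc J) zero = begin
    convolution lhsWeight 0 (suc J) 0
      ≈⟨ convolution-suc lhsWeight J 0 ⟩
    add2 (convolution lhsWeight 1 J 0) (mul2 w (G 0 0))
      ≈⟨ +-cong (convolution-recurrence lhsWeight 0 J 0) (*-congˡ {w} (G-initial moments 0)) ⟩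
    add2 (add2 (conv J 1) (add2 (mul2 (bθ 0) (conv J 0)) (mul2 (λθ 0) 𝟘))) (mul2 w 𝟙)
      ≈⟨ +-congʳ {mul2 w 𝟙} (+-cong (≋-trans (convolution-base J 1) (*-congˡ {r} (eval-fallingFactorial-1 (nat J))))
           (+-congʳ {mul2 (λθ 0) 𝟘}
             (*-congˡ {bθ 0} (≋-trans (convolution-base J 0) (*-congˡ {r} (eval-fallingFactorial-0 (nat J))))))) ⟩
    add2 (add2 (mul2 r (nat J)) (add2 (mul2 (bθ 0) (mul2 r 𝟙)) (mul2 (λθ 0) 𝟘))) (mul2 w 𝟙)
      ≈⟨ collect r (nat J) (bθ 0) (λθ 0) w ⟩
    add2 (mul2 r (add2 (nat J) (bθ 0))) w
      ≈⟨ rhsFactor-step₀ J ⟩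
    rhsFactor (suc J)
      ≈⟨ *-identityʳ (rhsFactor (suc J)) ⟨
    mul2 (rhsFactor (suc J)) 𝟙
      ≈⟨ *-congˡ {rhsFactor (suc J)} (eval-fallingFactorial-0 (nat (suc J))) ⟨
    mul2 (rhsFactor (suc J)) (eval (nat (suc J)) (fallingFactorial 0)) ∎
    where
    conv : ℕ → ℕ → P2
    conv = convolution lhsWeight 0
    r : P2
    r = rhsFactor J
    w : P2
    w = lhsWeight (suc J)
    collect : ∀ r n b l w →
      add2 (add2 (mul2 r n) (add2 (mul2 b (mul2 r 𝟙)) (mul2 l 𝟘))) (mul2 w 𝟙) ≋ add2 (mul2 r (add2 n b)) w
    collect = solve-∀ ℚ[X,Y]-almost
  convolution-base (suc J) (suc h) = begin
    convolution lhsWeight 0 (suc J) (suc h)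
      ≈⟨ convolution-suc lhsWeight J (suc h) ⟩
    add2 (convolution lhsWeight 1 J (suc h)) (mul2 w (G 0 (suc h)))
      ≈⟨ +-cong (convolution-recurrence lhsWeight 0 J (suc h)) (*-congˡ {w} (G-initial moments (suc h))) ⟩
    add2 (add2 (conv J (suc (suc h))) (add2 (mul2 b (conv J (suc h))) (mul2 l (conv J h)))) (mul2 w 𝟘)
      ≈⟨ +-congʳ {mul2 w 𝟘} (+-cong (≋-trans (convolution-base J (suc (suc h))) (*-congˡ {r} e₂))
           (+-cong (*-congˡ {b} (≋-trans (convolution-base J (suc h)) (*-congˡ {r} e₁)))
                   (*-congˡ {l} (convolution-base J h)))) ⟩
    add2 (add2 (mul2 r (mul2 (mul2 f d) d′)) (add2 (mul2 b (mul2 r (mul2 f d))) (mul2 l (mul2 r f)))) (mul2 w 𝟘)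
      ≈⟨ collect r f d d′ b l w ⟩
    mul2 r (mul2 f (add2 (mul2 d d′) (add2 (mul2 b d) l)))
      ≈⟨ *-congˡ {r} (*-congˡ {f} (contiguity J h)) ⟩
    mul2 r (mul2 f (rhsRatio J))
      ≈⟨ rhsFactor-step J f ⟩
    mul2 (rhsFactor (suc J)) (mul2 (nat (suc J)) f)
      ≈⟨ *-congˡ {rhsFactor (suc J)} (eval-fallingFactorial-at-suc J h) ⟨
    mul2 (rhsFactor (suc J)) (eval (nat (suc J)) (fallingFactorial (suc h))) ∎
    where
    conv : ℕ → ℕ → P2
    conv = convolution lhsWeight 0
    r : P2
    r = rhsFactor J
    w : P2
    w = lhsWeight (suc J)
    b : P2
    b = bθ (suc h)
    l : P2
    l = λθ (suc h)
    f : P2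
    f = eval (nat J) (fallingFactorial h)
    d : P2
    d = add2 (nat J) (neg2 (nat h))
    d′ : P2
    d′ = add2 (nat J) (neg2 (nat (suc h)))
    e₁ : eval (nat J) (fallingFactorial (suc h)) ≋ mul2 f d
    e₁ = eval-fallingFactorial-suc (nat J) h
    e₂ : eval (nat J) (fallingFactorial (suc (suc h))) ≋ mul2 (mul2 f d) d′
    e₂ = ≋-trans (eval-fallingFactorial-suc (nat J) (suc h)) (*-congʳ {d′} e₁)
    collect : ∀ r f d d′ b l w →
      add2 (add2 (mul2 r (mul2 (mul2 f d) d′)) (add2 (mul2 b (mul2 r (mul2 f d))) (mul2 l (mul2 r f)))) (mul2 w 𝟘)
      ≋ mul2 r (mul2 f (add2 (mul2 d d′) (add2 (mul2 b d) l)))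
    collect = solve-∀ ℚ[X,Y]-almost

  convolution-closed : ∀ s J h →
    convolution lhsWeight s J h ≋ mul2 (rhsFactor J) (eval (nat J) (P s h))
  convolution-closed zero J h = convolution-base J h
  convolution-closed (suc s) J h = begin
    convolution lhsWeight (suc s) J h
      ≈⟨ convolution-recurrence lhsWeight s J h ⟩
    add2 (conv (suc h)) (add2 (mul2 (bθ h) (conv h)) (mul2 (λθ h) (prev 𝟘 conv h)))
      ≈⟨ +-cong (convolution-closed s J (suc h))
                (+-cong (*-congˡ {bθ h} (convolution-closed s J h)) (*-congˡ {λθ h} (prev-closed h))) ⟩
    add2 (mul2 r (e (P s (suc h)))) (add2 (mul2 (bθ h) (mul2 r (e (P s h)))) (mul2 (λθ h) (mul2 r (e (prev [] (P s) h)))))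
      ≈⟨ factor r (e (P s (suc h))) (bθ h) (e (P s h)) (λθ h) (e (prev [] (P s) h)) ⟩
    mul2 r (add2 (e (P s (suc h))) (add2 (mul2 (bθ h) (e (P s h))) (mul2 (λθ h) (e (prev [] (P s) h)))))
      ≈⟨ *-congˡ {r} (≋-sym (≋-trans (eval-⊕ (nat J) (P s (suc h)) _)
           (+-congˡ {e (P s (suc h))} (≋-trans (eval-⊕ (nat J) (bθ h · P s h) _)
             (+-cong (eval-· (nat J) (bθ h) (P s h)) (eval-· (nat J) (λθ h) (prev [] (P s) h))))))) ⟩
    mul2 r (e (P (suc s) h)) ∎
    where
    conv : ℕ → P2
    conv = convolution lhsWeight s J
    r : P2
    r = rhsFactor J
    e : Px → P2
    e = eval (nat J)
    factor : ∀ r u b v l w →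
      add2 (mul2 r u) (add2 (mul2 b (mul2 r v)) (mul2 l (mul2 r w))) ≋ mul2 r (add2 u (add2 (mul2 b v) (mul2 l w)))
    factor = solve-∀ ℚ[X,Y]-almost
    prev-closed : ∀ h → prev 𝟘 conv h ≋ mul2 r (e (prev [] (P s) h))
    prev-closed zero = ≋-sym (zeroʳ r)
    prev-closed (suc h) = convolution-closed s J h

  moment-sum-closed : ∀ s J →
    sumTo J (λ k → mul2 (θ (J + s ∸ k)) (lhsWeight k)) ≋ mul2 (rhsFactor J) (eval (nat J) (P s 0))
  moment-sum-closed s J = ≋-trans
    (sumTo-cong J λ k _ → ≋-trans (*-comm (θ (J + s ∸ k)) (lhsWeight k))
                                  (*-congˡ {lhsWeight k} (≋-sym (G-zeroʳ (J + s ∸ k)))))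
    (convolution-closed s J 0)

𝟙≉𝟘 : ¬ (𝟙 ≈ 𝟘)
𝟙≉𝟘 𝟙≈𝟘 with 𝟙≈𝟘 0 0
... | ()

lemma5p3 : (θ : ℕ → P2) → IsMoments bθ λθ θ →
    (s : ℕ) → 1 ≤ s →
    Σ P2 λ d → ¬ (d ≈ 𝟘) ×
    Σ (Fin (suc s) → P2) λ c → ¬ (c (fromℕ s) ≈ 𝟘) ×
    ((J : ℕ) →
      mul2 d (sumTo J (λ k → mul2 (θ (J + s ∸ k))
        (smul2 (invFact k) (mul2 (poch (add2 𝕐 (cst (- 1ℚ))) k) (poch 𝕏 k)))))
      ≈ mul2 (evalJ s c J)
        (smul2 (invFact J) (mul2 (poch 𝕐 J) (poch (add2 𝕏 𝟙) J))))
lemma5p3 θ moments s _ = 𝟙 , 𝟙≉𝟘 , c , c-top≉𝟘 , λ J → ≋⇒≈ (identity J)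
  where
  open Moments θ moments
  Pₛ-isMonic : IsMonic (P s 0) s
  Pₛ-isMonic = subst (IsMonic (P s 0)) (ℕ.+-identityʳ s) (P-isMonic s 0)
  c : Fin (suc s) → P2
  c i = coeff (P s 0) (toℕ i)
  c-top≉𝟘 : ¬ (c (fromℕ s) ≈ 𝟘)
  c-top≉𝟘 c-top≈𝟘 = 𝟙≉𝟘 (≋⇒≈ (begin
    𝟙               ≈⟨ leading Pₛ-isMonic ⟨
    coeff (P s 0) s ≡⟨ cong (coeff (P s 0)) (toℕ-fromℕ s) ⟨
    c (fromℕ s)     ≈⟨ ≈⇒≋ c-top≈𝟘 ⟩
    𝟘               ∎))
  identity : ∀ J → mul2 𝟙 (sumTo J (λ k → mul2 (θ (J + s ∸ k)) (lhsWeight k))) ≋ mul2 (evalJ s c J) (rhsFactor J)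
  identity J = begin
    mul2 𝟙 (sumTo J (λ k → mul2 (θ (J + s ∸ k)) (lhsWeight k)))
      ≈⟨ *-identityˡ _ ⟩
    sumTo J (λ k → mul2 (θ (J + s ∸ k)) (lhsWeight k))
      ≈⟨ moment-sum-closed s J ⟩
    mul2 (rhsFactor J) (eval (nat J) (P s 0))
      ≈⟨ *-congˡ {rhsFactor J} (evalJ-coeff J s (P s 0) (hasDegree≤ Pₛ-isMonic)) ⟨
    mul2 (rhsFactor J) (evalJ s c J)
      ≈⟨ *-comm (rhsFactor J) (evalJ s c J) ⟩
    mul2 (evalJ s c J) (rhsFactor J) ∎
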